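{- Let $n\geq 2$ and let $\mathcal{F}$ be a directed 2-factorization of $\vec{C}_n \wr \vec{C}_3$ into four directed 2-factors. If $F\in \mathcal{F}$ is a type-1 2-factor that is a directed hamiltonian cycle of $\vec{C}_n \wr \vec{C}_3$, then $\sum_{i=0}^{n-1}s_i[F]$ is odd.
   Context: Let $V(\vec{C}_n)=\mathbb{Z}_n$ with arcs $(i,i+1)$ and $V(\vec{C}_3)=\mathbb{Z}_3$ with arcs $(j,j+1)$; $\vec{C}_n\wr\vec{C}_3$ has vertex set $\mathbb{Z}_n\times\mathbb{Z}_3$, with $((g_1,h_1),(g_2,h_2))$ an arc iff $g_2=g_1+1$, or $g_1=g_2$ and $h_2=h_1+1$. Write $i_j$ for $(i,j)$, $V_i=\{i_0,i_1,i_2\}$, and $C^i_3$ for the directed 3-cycle $i_0\,i_1\,i_2\,i_0$. A directed 2-factor is a spanning subdigraph that is a vertex-disjoint union of directed cycles; it is of type $k$ if it contains exactly $k$ arcs of $C^i_3$ for every $i\in\mathbb{Z}_n$. For a 2-factor $F$ and $i\in\mathbb{Z}_n$, let $F[i]$ be the subdigraph with vertex set $V_i\cup V_{i+1}$ whose arcs are the arcs of $F$ lying in $C^i_3$ or $C^{i+1}_3$ or going from $V_i$ to $V_{i+1}$. If $F$ is of type 1, then $F[i]$ is a union of two vertex-disjoint dipaths with total length 4, each containing exactly one arc from $V_i$ to $V_{i+1}$; $F$ is switched at $i$ if both of these dipaths have length 2, and $s_i[F]=1$ if $F$ is switched at $i$ and $s_i[F]=0$ otherwise. -}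

module Defs where

open import Data.Nat using (ℕ; zero; suc; _%_)
open import Data.Nat.DivMod using (m%n<n)
open import Data.Fin using (Fin; toℕ; fromℕ<; _≟_)
open import Data.Product using (Σ; ∃; ∃-syntax; ∃!; _×_; _,_; proj₁; proj₂)
open import Data.Product.Properties using (≡-dec)
open import Data.Sum using (_⊎_)
import Data.Empty
open import Data.List using (List; length; filter; tabulate; allFin)
open import Data.Nat.ListAction using (sum)
open import Relation.Binary.PropositionalEquality using (_≡_)
open import Relation.Binary.Definitions using (DecidableEquality)
open import Function.Definitions using (Injective; Bijective)

next : ∀ {n} → Fin n → Fin n
next {zero} ()
next {suc m} i = fromℕ< (m%n<n (suc (toℕ i)) (suc m))

Vertex : ℕ → Set
Vertex n = Fin n × Fin 3

_≟V_ : ∀ {n} → DecidableEquality (Vertex n)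
_≟V_ = ≡-dec _≟_ _≟_

Arc : ∀ {n} → Vertex n → Vertex n → Set
Arc (g₁ , h₁) (g₂ , h₂) = (g₂ ≡ next g₁) ⊎ ((g₁ ≡ g₂) × (h₂ ≡ next h₁))

-- A spanning subdigraph in which every vertex has in- and out-degree 1
-- (= a directed 2-factor) is given by its successor function f : arcs are (u , f u).
Is2Factor : ∀ {n} → (Vertex n → Vertex n) → Set
Is2Factor f = (∀ u → Arc u (f u)) × Bijective _≡_ _≡_ f

Is2Factorization4 : ∀ {n} → (Fin 4 → Vertex n → Vertex n) → Set
Is2Factorization4 {n} 𝓕 =
  (∀ k → Is2Factor (𝓕 k)) ×
  (∀ (u v : Vertex n) → Arc u v → ∃! _≡_ (λ k → 𝓕 k u ≡ v))

iter : ∀ {A : Set} → (A → A) → ℕ → A → A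
iter f zero x = x
iter f (suc m) x = f (iter f m x)

IsHamiltonian : ∀ {n} → (Vertex n → Vertex n) → Set
IsHamiltonian {n} f = ∀ (u v : Vertex n) → ∃[ m ] iter f m u ≡ v

arcsInC3 : ∀ {n} → (Vertex n → Vertex n) → Fin n → ℕ
arcsInC3 f i = length (filter (λ j → f (i , j) ≟V (i , next j)) (allFin 3))

IsType : ∀ {n} → ℕ → (Vertex n → Vertex n) → Set
IsType {n} k f = ∀ (i : Fin n) → arcsInC3 f i ≡ k

C3Arc : ∀ {n} → Fin n → Vertex n → Vertex n → Set
C3Arc i (g₁ , h₁) (g₂ , h₂) = (g₁ ≡ i) × (g₂ ≡ i) × (h₂ ≡ next h₁)

FArc : ∀ {n} → (Vertex n → Vertex n) → Fin n → Vertex n → Vertex n → Set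
FArc f i u v = (f u ≡ v) ×
  (C3Arc i u v ⊎ C3Arc (next i) u v ⊎ ((proj₁ u ≡ i) × (proj₁ v ≡ next i)))

-- F is switched at i : F[i] consists of two (vertex-disjoint) dipaths of length 2,
-- i.e. F[i] contains two vertex-disjoint dipaths p(k,0) p(k,1) p(k,2), k = 0,1.
Switched : ∀ {n} → (Vertex n → Vertex n) → Fin n → Set
Switched {n} f i = Σ (Fin 2 × Fin 3 → Vertex n) λ p →
  Injective _≡_ _≡_ p ×
  (∀ k → FArc f i (p (k , Fin.zero)) (p (k , Fin.suc Fin.zero)) ×
         FArc f i (p (k , Fin.suc Fin.zero)) (p (k , Fin.suc (Fin.suc Fin.zero))))

IsSwitchIndicator : ∀ {n} → (Vertex n → Vertex n) → (Fin n → ℕ) → Set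
IsSwitchIndicator {n} f s = ∀ (i : Fin n) →
  ((s i ≡ 1) × Switched f i) ⊎ ((s i ≡ 0) × (Switched f i → Data.Empty.⊥))

finSum : ∀ {n} → (Fin n → ℕ) → ℕ
finSum {n} s = sum (tabulate s)

{-# OPTIONS --safe #-}
-- In every layer Vᵢ a type-1 factor F uses a single arc a → a+1 of C³ᵢ, so the two other
-- vertices a+1 and a+2 of Vᵢ leave for Vᵢ₊₁. They cannot enter the head b+1 of the arc
-- b → b+1 that F uses in Vᵢ₊₁, hence F maps them onto {b, b+2}: either straight
-- (a+1 ↦ b, a+2 ↦ b+2) or crossed (a+1 ↦ b+2, a+2 ↦ b), and F is switched at i exactly
-- when it is crossed. Colour the endpoints a, a+1 of the used arc of each layer black and
-- a+2 white, then invert the colours of all layers preceded by an odd number of switches.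
-- If the total number of switches is even, this colouring is consistent around ℤₙ and
-- preserved by F, so F cannot be a single cycle through a black and a white vertex.
module Submission where

open import Defs
open import Data.Nat using (ℕ; zero; suc; _+_; _≤_; _%_; s≤s; z≤n)
open import Data.Nat.DivMod using (m<n⇒m%n≡m; n%n≡0)
open import Data.Nat.Properties using (+-identityʳ; +-assoc; 1+n≢n)
open import Data.Fin using (Fin; zero; suc; toℕ; fromℕ; inject₁; _≟_)
open import Data.Fin.Patterns using (0F; 1F; 2F)
open import Data.Fin.Properties
  using (0≢1+n; toℕ-injective; toℕ-fromℕ<; toℕ-fromℕ; toℕ-inject₁; toℕ<n)
open import Data.Fin.Relation.Unary.Top using (view; ‵fromℕ; ‵inject₁)
open import Data.Bool using (Bool; true; false; not; _xor_)
open import Data.Bool.Properties using (not-involutive; not-distribˡ-xor; ¬-not; not-¬)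
open import Data.Empty using (⊥; ⊥-elim)
open import Data.Sum using (_⊎_; inj₁; inj₂)
open import Data.Product using (∃; _×_; _,_; proj₁; proj₂)
open import Data.List using (List; []; _∷_; length; filter; allFin)
open import Data.List.Membership.Propositional using (_∈_)
open import Data.List.Membership.Propositional.Properties
  using (∈-filter⁺; ∈-filter⁻; ∈-allFin)
open import Data.List.Relation.Unary.Any using (here)
open import Data.List.Relation.Unary.Any.Properties using (singleton⁻)
open import Function using (_∘_)
open import Function.Definitions using (Injective)
open import Relation.Nullary using (¬_; yes; no; contradiction)
open import Relation.Unary using (Decidable)
open import Relation.Binary.PropositionalEquality
  using (_≡_; _≢_; refl; sym; trans; cong; cong₂; subst; module ≡-Reasoning)

open ≡-Reasoning

parity : ℕ → Bool
parity zero    = false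
parity (suc n) = not (parity n)

parity-+ : ∀ m n → parity (m + n) ≡ parity m xor parity n
parity-+ zero    n = refl
parity-+ (suc m) n = trans (cong not (parity-+ m n)) (not-distribˡ-xor (parity m) (parity n))

parity≡true⇒%2≡1 : ∀ n → parity n ≡ true → n % 2 ≡ 1
parity≡true⇒%2≡1 zero          ()
parity≡true⇒%2≡1 (suc zero)    _   = refl
parity≡true⇒%2≡1 (suc (suc n)) odd =
  parity≡true⇒%2≡1 n (trans (sym (not-involutive (parity n))) odd)

xor-cancelʳ : ∀ x y z → (x xor z) xor (y xor z) ≡ x xor y
xor-cancelʳ false false false = refl
xor-cancelʳ false false true  = refl
xor-cancelʳ false true  false = refl
xor-cancelʳ false true  true  = refl
xor-cancelʳ true  false false = refl
xor-cancelʳ true  false true  = refl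
xor-cancelʳ true  true  false = refl
xor-cancelʳ true  true  true  = refl

count≡1⇒unique : ∀ {A : Set} {P : A → Set} (P? : Decidable P) (xs : List A) →
                 (∀ x → x ∈ xs) → length (filter P? xs) ≡ 1 →
                 ∃ λ a → P a × (∀ x → P x → x ≡ a)
count≡1⇒unique P? xs complete one with filter P? xs in eq
count≡1⇒unique P? xs complete () | []
count≡1⇒unique P? xs complete () | _ ∷ _ ∷ _
count≡1⇒unique P? xs complete _ | a ∷ [] =
  a , proj₂ (∈-filter⁻ P? {xs = xs} (subst (a ∈_) (sym eq) (here refl))) ,
  λ x Px → singleton⁻ (subst (x ∈_) eq (∈-filter⁺ P? (complete x) Px))

next-inject₁ : ∀ {n} (i : Fin n) → next (inject₁ i) ≡ suc i
next-inject₁ {n} i = toℕ-injective (begin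
  toℕ (next (inject₁ i))        ≡⟨ toℕ-fromℕ< _ ⟩
  suc (toℕ (inject₁ i)) % suc n ≡⟨ cong (λ k → suc k % suc n) (toℕ-inject₁ i) ⟩
  suc (toℕ i) % suc n           ≡⟨ m<n⇒m%n≡m (s≤s (toℕ<n i)) ⟩
  suc (toℕ i)                   ∎)

next-fromℕ : ∀ n → next (fromℕ n) ≡ zero
next-fromℕ n = toℕ-injective (begin
  toℕ (next (fromℕ n))        ≡⟨ toℕ-fromℕ< _ ⟩
  suc (toℕ (fromℕ n)) % suc n ≡⟨ cong (λ k → suc k % suc n) (toℕ-fromℕ n) ⟩
  suc n % suc n               ≡⟨ n%n≡0 (suc n) ⟩
  0                           ∎)

next≢ : ∀ {n} (i : Fin (suc (suc n))) → next i ≢ i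
next≢ i with view i
... | ‵fromℕ     = λ e → 0≢1+n (trans (sym (next-fromℕ _)) e)
... | ‵inject₁ j =
  λ e → 1+n≢n (trans (cong toℕ (trans (sym (next-inject₁ j)) e)) (toℕ-inject₁ j))

next²≢ : ∀ (a : Fin 3) → next (next a) ≢ a
next²≢ 0F ()
next²≢ 1F ()
next²≢ 2F ()

data Position (a : Fin 3) : Fin 3 → Set where
  at₀ : Position a a
  at₁ : Position a (next a)
  at₂ : Position a (next (next a))

position : ∀ a x → Position a x
position 0F 0F = at₀
position 0F 1F = at₁
position 0F 2F = at₂
position 1F 0F = at₂
position 1F 1F = at₀
position 1F 2F = at₁
position 2F 0F = at₁
position 2F 1F = at₂
position 2F 2F = at₀

shift : Fin 3 → Fin 3 → Fin 3
shift a 0F = a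
shift a 1F = next a
shift a 2F = next (next a)

shift-injective : ∀ a → Injective _≡_ _≡_ (shift a)
shift-injective a {0F} {0F} _ = refl
shift-injective a {0F} {1F} e = ⊥-elim (next≢ a (sym e))
shift-injective a {0F} {2F} e = ⊥-elim (next²≢ a (sym e))
shift-injective a {1F} {0F} e = ⊥-elim (next≢ a e)
shift-injective a {1F} {1F} _ = refl
shift-injective a {1F} {2F} e = ⊥-elim (next≢ (next a) (sym e))
shift-injective a {2F} {0F} e = ⊥-elim (next²≢ a e)
shift-injective a {2F} {1F} e = ⊥-elim (next≢ (next a) e)
shift-injective a {2F} {2F} _ = refl

onInnerArc : Fin 3 → Fin 3 → Bool
onInnerArc 0F 2F = false
onInnerArc 1F 0F = false
onInnerArc 2F 1F = false
onInnerArc _  _  = true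

onInnerArc-tail : ∀ a → onInnerArc a a ≡ true
onInnerArc-tail 0F = refl
onInnerArc-tail 1F = refl
onInnerArc-tail 2F = refl

onInnerArc-head : ∀ a → onInnerArc a (next a) ≡ true
onInnerArc-head 0F = refl
onInnerArc-head 1F = refl
onInnerArc-head 2F = refl

onInnerArc-off : ∀ a → onInnerArc a (next (next a)) ≡ false
onInnerArc-off 0F = refl
onInnerArc-off 1F = refl
onInnerArc-off 2F = refl

-- The dipaths a → a+1 → b+2 and a+2 → b → b+1 of a switched F[i], each vertex given as
-- (0 for Vᵢ or 1 for Vᵢ₊₁ , offset from the tail a resp. b of the arc of C³ used by F).
switchedRoute : Fin 2 × Fin 3 → Fin 2 × Fin 3
switchedRoute (0F , 0F) = (0F , 0F)
switchedRoute (0F , 1F) = (0F , 1F)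
switchedRoute (0F , 2F) = (1F , 2F)
switchedRoute (1F , 0F) = (0F , 2F)
switchedRoute (1F , 1F) = (1F , 0F)
switchedRoute (1F , 2F) = (1F , 1F)

switchedRoute⁻¹ : Fin 2 × Fin 3 → Fin 2 × Fin 3
switchedRoute⁻¹ (0F , 0F) = (0F , 0F)
switchedRoute⁻¹ (0F , 1F) = (0F , 1F)
switchedRoute⁻¹ (1F , 2F) = (0F , 2F)
switchedRoute⁻¹ (0F , 2F) = (1F , 0F)
switchedRoute⁻¹ (1F , 0F) = (1F , 1F)
switchedRoute⁻¹ (1F , 1F) = (1F , 2F)

switchedRoute⁻¹-inverse : ∀ x → switchedRoute⁻¹ (switchedRoute x) ≡ x
switchedRoute⁻¹-inverse (0F , 0F) = refl
switchedRoute⁻¹-inverse (0F , 1F) = refl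
switchedRoute⁻¹-inverse (0F , 2F) = refl
switchedRoute⁻¹-inverse (1F , 0F) = refl
switchedRoute⁻¹-inverse (1F , 1F) = refl
switchedRoute⁻¹-inverse (1F , 2F) = refl

switchedRoute-injective : Injective _≡_ _≡_ switchedRoute
switchedRoute-injective {x} {y} e = begin
  x                                  ≡⟨ sym (switchedRoute⁻¹-inverse x) ⟩
  switchedRoute⁻¹ (switchedRoute x)  ≡⟨ cong switchedRoute⁻¹ e ⟩
  switchedRoute⁻¹ (switchedRoute y)  ≡⟨ switchedRoute⁻¹-inverse y ⟩
  y                                  ∎

prefixSum : ∀ {n} → (Fin n → ℕ) → Fin (suc n) → ℕ
prefixSum s 0F = 0
prefixSum {suc n} s (suc i) = s 0F + prefixSum (s ∘ suc) i

prefixSum-fromℕ : ∀ {n} (s : Fin n → ℕ) → prefixSum s (fromℕ n) ≡ finSum s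
prefixSum-fromℕ {zero}  s = refl
prefixSum-fromℕ {suc n} s = cong (s 0F +_) (prefixSum-fromℕ (s ∘ suc))

prefixSum-suc : ∀ {n} (s : Fin n → ℕ) i →
                prefixSum s (suc i) ≡ prefixSum s (inject₁ i) + s i
prefixSum-suc s 0F      = +-identityʳ (s 0F)
prefixSum-suc s (suc i) =
  trans (cong (s 0F +_) (prefixSum-suc (s ∘ suc) i)) (sym (+-assoc (s 0F) _ _))

prefixParity : ∀ {n} → (Fin n → ℕ) → Fin n → Bool
prefixParity s i = parity (prefixSum s (inject₁ i))

prefixParity-next : ∀ {n} (s : Fin (suc n) → ℕ) → parity (finSum s) ≡ false →
                    ∀ i → prefixParity s (next i) ≡ prefixParity s i xor parity (s i)
prefixParity-next {n} s even i with view i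
... | ‵fromℕ = begin
  prefixParity s (next (fromℕ n))
    ≡⟨ cong (prefixParity s) (next-fromℕ n) ⟩
  false
    ≡⟨ sym even ⟩
  parity (finSum s)
    ≡⟨ cong parity (sym (prefixSum-fromℕ s)) ⟩
  parity (prefixSum s (suc (fromℕ n)))
    ≡⟨ cong parity (prefixSum-suc s (fromℕ n)) ⟩
  parity (prefixSum s (inject₁ (fromℕ n)) + s (fromℕ n))
    ≡⟨ parity-+ (prefixSum s (inject₁ (fromℕ n))) _ ⟩
  prefixParity s (fromℕ n) xor parity (s (fromℕ n)) ∎
... | ‵inject₁ j = begin
  prefixParity s (next (inject₁ j))
    ≡⟨ cong (prefixParity s) (next-inject₁ j) ⟩
  parity (prefixSum s (suc (inject₁ j)))
    ≡⟨ cong parity (prefixSum-suc s (inject₁ j)) ⟩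
  parity (prefixSum s (inject₁ (inject₁ j)) + s (inject₁ j))
    ≡⟨ parity-+ (prefixSum s (inject₁ (inject₁ j))) _ ⟩
  prefixParity s (inject₁ j) xor parity (s (inject₁ j)) ∎

iter-invariant : ∀ {A B : Set} {f : A → A} (c : A → B) → (∀ x → c (f x) ≡ c x) →
                 ∀ k x → c (iter f k x) ≡ c x
iter-invariant c invariant zero    x = refl
iter-invariant c invariant (suc k) x = trans (invariant _) (iter-invariant c invariant k x)

hamiltonian-invariant⇒constant : ∀ {n} {f : Vertex n → Vertex n} {B : Set} →
                                 IsHamiltonian f → (c : Vertex n → B) →
                                 (∀ u → c (f u) ≡ c u) → ∀ u v → c u ≡ c v
hamiltonian-invariant⇒constant hamiltonian c invariant u v with hamiltonian u v
... | k , u↝v = trans (sym (iter-invariant c invariant k u)) (cong c u↝v)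

module Type1 {m : ℕ} (f : Vertex (suc (suc m)) → Vertex (suc (suc m)))
             (f-arc : ∀ u → Arc u (f u)) (f-injective : Injective _≡_ _≡_ f)
             (type1 : IsType 1 f) where

  private
    n : ℕ
    n = suc (suc m)

  innerArc : ∀ i → ∃ λ a → f (i , a) ≡ (i , next a) ×
                           (∀ j → f (i , j) ≡ (i , next j) → j ≡ a)
  innerArc i = count≡1⇒unique (λ j → f (i , j) ≟V (i , next j)) (allFin 3) ∈-allFin (type1 i)

  inner : Fin n → Fin 3
  inner i = proj₁ (innerArc i)

  f-inner : ∀ i → f (i , inner i) ≡ (i , next (inner i))
  f-inner i = proj₁ (proj₂ (innerArc i))

  inner-unique : ∀ {i j} → f (i , j) ≡ (i , next j) → j ≡ inner i
  inner-unique {i} {j} = proj₂ (proj₂ (innerArc i)) j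

  leaves : ∀ {i j} → j ≢ inner i → proj₁ (f (i , j)) ≡ next i
  leaves {i} {j} j≢ with f-arc (i , j)
  ... | inj₁ e         = e
  ... | inj₂ (e₁ , e₂) = ⊥-elim (j≢ (inner-unique (cong₂ _,_ (sym e₁) e₂)))

  landing : ∀ {i j} → j ≢ inner i → ∃ λ r → f (i , j) ≡ (next i , r)
  landing {i} {j} j≢ = proj₂ (f (i , j)) , cong (_, proj₂ (f (i , j))) (leaves j≢)

  misses-head : ∀ {i j} → f (i , j) ≢ (next i , next (inner (next i)))
  misses-head {i} e =
    next≢ i (sym (cong proj₁ (f-injective (trans e (sym (f-inner (next i)))))))

  exits-distinct : ∀ {i} → f (i , next (inner i)) ≢ f (i , next (next (inner i)))
  exits-distinct {i} e = next≢ (next (inner i)) (sym (cong proj₂ (f-injective e)))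

  data Crossing (i : Fin n) : Set where
    straight : f (i , next (inner i)) ≡ (next i , inner (next i)) →
               f (i , next (next (inner i))) ≡ (next i , next (next (inner (next i)))) →
               Crossing i
    crossed  : f (i , next (inner i)) ≡ (next i , next (next (inner (next i)))) →
               f (i , next (next (inner i))) ≡ (next i , inner (next i)) →
               Crossing i

  isCrossed : ∀ {i} → Crossing i → Bool
  isCrossed (straight _ _) = false
  isCrossed (crossed _ _)  = true

  crossing : ∀ i → Crossing i
  crossing i with landing {i} (next≢ (inner i)) | landing {i} (next²≢ (inner i))
  ... | r , x↦r | r′ , z↦r′ with position (inner (next i)) r | position (inner (next i)) r′
  ... | at₀ | at₂ = straight x↦r z↦r′
  ... | at₂ | at₀ = crossed x↦r z↦r′
  ... | at₁ | _   = ⊥-elim (misses-head x↦r)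
  ... | _   | at₁ = ⊥-elim (misses-head z↦r′)
  ... | at₀ | at₀ = ⊥-elim (exits-distinct (trans x↦r (sym z↦r′)))
  ... | at₂ | at₂ = ⊥-elim (exits-distinct (trans x↦r (sym z↦r′)))

  C3Arc-tail : ∀ {i w v} → f w ≡ v → C3Arc i w v → w ≡ (i , inner i)
  C3Arc-tail {w = _ , _} {v = _ , _} w↦v (refl , refl , refl) = cong (_ ,_) (inner-unique w↦v)

  C3Arc-head : ∀ {i u w} → f u ≡ w → C3Arc i u w → w ≡ (i , next (inner i))
  C3Arc-head {i} u↦w c = trans (sym u↦w) (trans (cong f (C3Arc-tail u↦w c)) (f-inner i))

  arrives-in-layer : ∀ {i u w} → FArc f i u w → proj₁ w ≡ i → w ≡ (i , next (inner i))
  arrives-in-layer (u↦w , inj₁ c) _ = C3Arc-head u↦w c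
  arrives-in-layer {i} (_ , inj₂ (inj₁ (_ , w∈Vᵢ₊₁ , _))) w∈Vᵢ =
    ⊥-elim (next≢ i (trans (sym w∈Vᵢ₊₁) w∈Vᵢ))
  arrives-in-layer {i} (_ , inj₂ (inj₂ (_ , w∈Vᵢ₊₁))) w∈Vᵢ =
    ⊥-elim (next≢ i (trans (sym w∈Vᵢ₊₁) w∈Vᵢ))

  path-middle : ∀ {i u w v} → FArc f i u w → FArc f i w v →
                w ≡ (i , next (inner i)) ⊎ w ≡ (next i , inner (next i))
  path-middle {i} u→w (w↦v , inj₁ c) = ⊥-elim (next≢ (inner i) (cong proj₂ head≡tail))
    where
    head≡tail = trans (sym (arrives-in-layer u→w (proj₁ c))) (C3Arc-tail w↦v c)
  path-middle u→w (w↦v , inj₂ (inj₁ c))       = inj₂ (C3Arc-tail w↦v c)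
  path-middle u→w (_ , inj₂ (inj₂ (w∈Vᵢ , _))) = inj₁ (arrives-in-layer u→w w∈Vᵢ)

  straight⇒unswitched : ∀ {i} → f (i , next (inner i)) ≡ (next i , inner (next i)) → ¬ Switched f i
  straight⇒unswitched {i} x↦y (p , p-injective , path) = middles (middle 0F) (middle 1F)
    where
    X Y : Vertex n
    X = (i , next (inner i))
    Y = (next i , inner (next i))

    middle : ∀ k → p (k , 1F) ≡ X ⊎ p (k , 1F) ≡ Y
    middle k = path-middle (proj₁ (path k)) (proj₂ (path k))

    X-then-Y : ∀ k {l} → p (k , 1F) ≡ X → p l ≡ Y → p (k , 2F) ≡ p l
    X-then-Y k mX mY =
      trans (sym (proj₁ (proj₂ (path k)))) (trans (cong f mX) (trans x↦y (sym mY)))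

    -- Distinct dipaths have distinct middles, so one runs through X; as f X = Y, it then ends
    -- at the middle of the other one.

    middles : p (0F , 1F) ≡ X ⊎ p (0F , 1F) ≡ Y → p (1F , 1F) ≡ X ⊎ p (1F , 1F) ≡ Y → ⊥
    middles (inj₁ m₀) (inj₁ m₁) = contradiction (p-injective (trans m₀ (sym m₁))) λ ()
    middles (inj₂ m₀) (inj₂ m₁) = contradiction (p-injective (trans m₀ (sym m₁))) λ ()
    middles (inj₁ m₀) (inj₂ m₁) = contradiction (p-injective (X-then-Y 0F m₀ m₁)) λ ()
    middles (inj₂ m₀) (inj₁ m₁) = contradiction (p-injective (X-then-Y 1F m₁ m₀)) λ ()

  crossed⇒switched : ∀ {i} → f (i , next (inner i)) ≡ (next i , next (next (inner (next i)))) →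
                     f (i , next (next (inner i))) ≡ (next i , inner (next i)) → Switched f i
  crossed⇒switched {i} x↦ z↦ =
    embed ∘ switchedRoute , switchedRoute-injective ∘ embed-injective , paths
    where
    embed : Fin 2 × Fin 3 → Vertex n
    embed (0F , r) = (i , shift (inner i) r)
    embed (1F , r) = (next i , shift (inner (next i)) r)

    embed-injective : Injective _≡_ _≡_ embed
    embed-injective {0F , _} {0F , _} e =
      cong (0F ,_) (shift-injective (inner i) (cong proj₂ e))
    embed-injective {1F , _} {1F , _} e =
      cong (1F ,_) (shift-injective (inner (next i)) (cong proj₂ e))
    embed-injective {0F , _} {1F , _} e = ⊥-elim (next≢ i (sym (cong proj₁ e)))
    embed-injective {1F , _} {0F , _} e = ⊥-elim (next≢ i (cong proj₁ e))

    paths : ∀ k → FArc f i (embed (switchedRoute (k , 0F))) (embed (switchedRoute (k , 1F))) ×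
                  FArc f i (embed (switchedRoute (k , 1F))) (embed (switchedRoute (k , 2F)))
    paths 0F = (f-inner i , inj₁ (refl , refl , refl)) , (x↦ , inj₂ (inj₂ (refl , refl)))
    paths 1F = (z↦ , inj₂ (inj₂ (refl , refl))) ,
               (f-inner (next i) , inj₂ (inj₁ (refl , refl , refl)))

  switchIndicator-parity : ∀ {s} → IsSwitchIndicator f s →
                           ∀ i → parity (s i) ≡ isCrossed (crossing i)
  switchIndicator-parity indicator i with indicator i | crossing i
  ... | inj₁ (s≡1 , _)   | crossed _ _    = cong parity s≡1
  ... | inj₂ (s≡0 , _)   | straight _ _   = cong parity s≡0
  ... | inj₁ (_ , sw)    | straight x↦ _  = ⊥-elim (straight⇒unswitched x↦ sw)
  ... | inj₂ (_ , unsw)  | crossed x↦ z↦ = ⊥-elim (unsw (crossed⇒switched x↦ z↦))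

  crossing-colour : ∀ {i j} (c : Crossing i) → j ≢ inner i →
                    onInnerArc (inner (next i)) (proj₂ (f (i , j))) ≡
                    onInnerArc (inner i) j xor isCrossed c
  crossing-colour {i} {j} (straight x↦ z↦) j≢ with position (inner i) j
  ... | at₀ = ⊥-elim (j≢ refl)
  ... | at₁ rewrite x↦ | onInnerArc-tail (inner (next i)) | onInnerArc-head (inner i) = refl
  ... | at₂ rewrite z↦ | onInnerArc-off (inner (next i))  | onInnerArc-off (inner i)  = refl
  crossing-colour {i} {j} (crossed x↦ z↦) j≢ with position (inner i) j
  ... | at₀ = ⊥-elim (j≢ refl)
  ... | at₁ rewrite x↦ | onInnerArc-off (inner (next i))  | onInnerArc-head (inner i) = refl
  ... | at₂ rewrite z↦ | onInnerArc-tail (inner (next i)) | onInnerArc-off (inner i)  = refl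

  colour : (Fin n → Bool) → Vertex n → Bool
  colour t (i , j) = onInnerArc (inner i) j xor t i

  colour-invariant : ∀ t → (∀ i → t (next i) ≡ t i xor isCrossed (crossing i)) →
                     ∀ u → colour t (f u) ≡ colour t u
  colour-invariant t t-next (i , j) with j ≟ inner i
  ... | yes refl rewrite f-inner i | onInnerArc-head (inner i) | onInnerArc-tail (inner i) = refl
  ... | no j≢ = begin
    colour t (f (i , j))
      ≡⟨ cong (λ g → onInnerArc (inner g) (proj₂ (f (i , j))) xor t g) (leaves j≢) ⟩
    onInnerArc (inner (next i)) (proj₂ (f (i , j))) xor t (next i)
      ≡⟨ cong₂ _xor_ (crossing-colour (crossing i) j≢) (t-next i) ⟩
    (onInnerArc (inner i) j xor isCrossed (crossing i)) xor (t i xor isCrossed (crossing i))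
      ≡⟨ xor-cancelʳ (onInnerArc (inner i) j) (t i) (isCrossed (crossing i)) ⟩
    colour t (i , j) ∎

  colour-separates : ∀ t i → colour t (i , inner i) ≢ colour t (i , next (next (inner i)))
  colour-separates t i rewrite onInnerArc-tail (inner i) | onInnerArc-off (inner i) =
    not-¬ refl ∘ sym

lemma6p16 : ∀ (n : ℕ) → 2 ≤ n →
    (𝓕 : Fin 4 → Vertex n → Vertex n) → Is2Factorization4 𝓕 →
    (k : Fin 4) → IsType 1 (𝓕 k) → IsHamiltonian (𝓕 k) →
    (s : Fin n → ℕ) → IsSwitchIndicator (𝓕 k) s →
    finSum s % 2 ≡ 1
lemma6p16 (suc (suc m)) (s≤s (s≤s z≤n)) 𝓕 (factors , _) k type1 hamiltonian s switch =
  parity≡true⇒%2≡1 (finSum s) (¬-not switches-not-even)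
  where
  open Type1 (𝓕 k) (proj₁ (factors k)) (proj₁ (proj₂ (factors k))) type1

  switches-not-even : parity (finSum s) ≢ false
  switches-not-even even =
    colour-separates t 0F
      (hamiltonian-invariant⇒constant hamiltonian (colour t) (colour-invariant t t-next) _ _)
    where
    t : Fin (suc (suc m)) → Bool
    t = prefixParity s

    t-next : ∀ i → t (next i) ≡ t i xor isCrossed (crossing i)
    t-next i =
      trans (prefixParity-next s even i) (cong (t i xor_) (switchIndicator-parity switch i))
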